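{- Let $k\ge1$ and let $\overrightarrow{P}$ be an oriented path from $u$ to $v$ of length $4k$ with an even number of forward arcs, and $\overrightarrow{P'}$ an oriented path from $u'$ to $v'$ of length $4k$ with an odd number of forward arcs (forward with respect to traversal from the first to the last endpoint). Then for every color $i\in\{0,\dots,2k\}$ at $u$, $u$ allows every color at $v$; and for every color $i$ at $u'$, $u'$ allows at $v'$ every color except $i$ (and does not allow $i$).
   Context: The directed cycle $\overrightarrow{C}_{2k+1}$ has vertices $0,\dots,2k$ and arcs $i\to i+1\pmod{2k+1}$. A pushable $\overrightarrow{C}_{2k+1}$-coloring of an oriented graph assigns colors in $\{0,\dots,2k\}$ such that, after pushing some set of vertices (pushing a vertex reverses all arcs incident to it), every arc $xy$ satisfies color$(y)\equiv$ color$(x)+1\pmod{2k+1}$. For an oriented path $u=w_0,w_1,\dots,w_{n-1},w_n=v$, with $u$ colored $i$, we say $u$ allows the color $j$ at $v$ if there is a subset of the internal vertices $w_1,\dots,w_{n-1}$ which, when pushed, yields an orientation of the path admitting such a coloring (arc-preserving map to $\overrightarrow{C}_{2k+1}$) with $u$ colored $i$ and $v$ colored $j$. -}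

module Defs where

open import Data.Nat using (ℕ; zero; suc; _+_; _*_; _%_)
open import Data.Fin using (Fin; toℕ; fromℕ; inject₁; zero; suc)
open import Data.Bool using (Bool; true; false; _xor_; if_then_else_; _≟_)
open import Data.Vec using (Vec; lookup; count; tabulate)
open import Data.Product using (Σ; _×_; ∃; _,_)
open import Relation.Binary.PropositionalEquality using (_≡_)

-- Colors of the directed cycle C_{2k+1}: Fin (2k+1); arc a → a+1 (mod 2k+1).
Color : ℕ → Set
Color k = Fin (suc (2 * k))

CycArc : (k : ℕ) → Color k → Color k → Set
CycArc k a b = toℕ b ≡ (toℕ a + 1) % suc (2 * k)

-- An oriented path w_0, ..., w_n of length n: entry j (j < n) is true iff the
-- arc between w_j and w_{j+1} is oriented forward, w_j → w_{j+1}.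
OPath : ℕ → Set
OPath n = Vec Bool n

forwardArcs : ∀ {n} → OPath n → ℕ
forwardArcs {n} P = count (λ b → b ≟ true) P

-- Orientation of arc j after pushing the vertex set S (S w = true iff w pushed):
-- the arc is reversed iff exactly one of its endpoints is pushed.
pushedArc : ∀ {n} → OPath n → (Fin (suc n) → Bool) → OPath n
pushedArc P S = tabulate λ j → lookup P j xor (S (inject₁ j) xor S (suc j))

IsHom : (k : ℕ) {n : ℕ} → OPath n → (Fin (suc n) → Color k) → Set
IsHom k {n} P c = (j : Fin n) →
  if P' j then CycArc k (c (inject₁ j)) (c (suc j))
          else CycArc k (c (suc j)) (c (inject₁ j))
  where P' = λ j → lookup P j

Allows : (k : ℕ) {n : ℕ} → OPath n → Color k → Color k → Set
Allows k {n} P i j =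
  Σ (Fin (suc n) → Bool) λ S →
    (S zero ≡ false) × (S (fromℕ n) ≡ false) ×
    Σ (Fin (suc n) → Color k) λ c →
      IsHom k (pushedArc P S) c × (c zero ≡ i) × (c (fromℕ n) ≡ j)

module Submission where

-- Pushing internal vertices can turn a path into any orientation with the same
-- parity of forward arcs, and nothing else.  Following arcs from colour i gives
-- a homomorphism of an oriented path with f forward arcs out of n, ending at
-- i + f − (n − f) modulo 2k + 1, and every homomorphism is of this form.  Hence
-- i allows j exactly when some f ≤ n of the path's parity solves
-- i + 2f ≡ j + n (mod 2k + 1).  For n = 4k, as 2 is invertible modulo 2k + 1,
-- the solutions are some f₀ ≤ 2k and f₀ + 2k + 1, of opposite parities; the
-- latter exceeds 4k only when f₀ = 2k, i.e. when j = i, leaving only the even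
-- solution.

open import Defs
open import Data.Nat using (ℕ; _*_; _%_; _≥_)
open import Data.Product using (_×_)
open import Relation.Binary.PropositionalEquality using (_≡_; _≢_)
open import Relation.Nullary using (¬_)

open import Level using (0ℓ)
open import Data.Nat using (zero; suc; pred; z≤n; s≤s; _+_; _∸_; _≤_; _<_; _<?_; _≟_; NonZero)
open import Data.Nat.Properties
  using ( ≤-refl; ≤-trans; m≤n*m; ≤∧≢⇒<; ≮⇒≥; n≤1+n; 1+n≰n; +-identityʳ
        ; +-monoʳ-≤; +-comm; +-suc; ≤-pred; suc-pred; m∸n+n≡m; m<n+o⇒m∸n<o )
open import Data.Nat.DivMod
  using ( _mod_; m%n%n≡m%n; m≤n⇒[n∸m]%m≡n%m; %-distribˡ-+; %-distribˡ-*; [m+kn]%n≡m%n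
        ; m<n⇒m%n≡m; m%n<n )
open import Data.Nat.Tactic.RingSolver using (solve-∀)
open import Data.Fin using (Fin; toℕ; fromℕ) renaming (zero to fzero; suc to fsuc)
open import Data.Fin.Properties using (toℕ-injective; toℕ<n; toℕ-fromℕ<)
open import Data.Bool using (Bool; true; false; not; _xor_; if_then_else_)
import Data.Bool as Bool
open import Data.Bool.Properties
  using (not-involutive; not-distribˡ-xor; xor-same; xor-identityʳ; not-¬; ¬-not; xor-∧-commutativeRing)
open import Data.Vec using ([]; _∷_)
open import Data.Vec.Properties using (count≤n)
open import Data.Product using (∃; _,_)
open import Function using (_∘′_; _⇔_; mk⇔; Equivalence)
open import Relation.Binary using (Setoid)
import Relation.Binary.Reasoning.Setoid as SetoidReasoning
open import Relation.Binary.PropositionalEquality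
  using (refl; sym; trans; cong; cong₂; subst; subst₂; module ≡-Reasoning)
open import Relation.Nullary using (yes; no; contradiction)
open import Algebra.Solver.Ring.AlmostCommutativeRing using (fromCommutativeRing)
import Algebra.Solver.Ring.Simple as RingSolver

open RingSolver (fromCommutativeRing xor-∧-commutativeRing) Bool._≟_
  using (solve; _:=_; _:+_)

oddᵇ : ℕ → Bool
oddᵇ zero    = false
oddᵇ (suc n) = not (oddᵇ n)

oddᵇ-+ : ∀ a b → oddᵇ (a + b) ≡ oddᵇ a xor oddᵇ b
oddᵇ-+ zero    b = refl
oddᵇ-+ (suc a) b = trans (cong not (oddᵇ-+ a b)) (not-distribˡ-xor (oddᵇ a) (oddᵇ b))

oddᵇ-2* : ∀ k → oddᵇ (2 * k) ≡ false
oddᵇ-2* k rewrite +-identityʳ k | oddᵇ-+ k k = xor-same (oddᵇ k)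

oddᵇ-%2 : ∀ n → oddᵇ (n % 2) ≡ oddᵇ n
oddᵇ-%2 zero          = refl
oddᵇ-%2 (suc zero)    = refl
oddᵇ-%2 (suc (suc n)) = trans (oddᵇ-%2 n) (sym (not-involutive (oddᵇ n)))

module Congruence (m : ℕ) .{{_ : NonZero m}} where

  infix 4 _≈_
  record _≈_ (a b : ℕ) : Set where
    constructor mk≈
    field %-≡ : a % m ≡ b % m

  ≈-setoid : Setoid 0ℓ 0ℓ
  ≈-setoid = record
    { Carrier       = ℕ
    ; _≈_           = _≈_
    ; isEquivalence = record
      { refl  = mk≈ refl
      ; sym   = λ (mk≈ e) → mk≈ (sym e)
      ; trans = λ (mk≈ e) (mk≈ e′) → mk≈ (trans e e′)
      }
    }

  open Setoid ≈-setoid public using () renaming (refl to ≈-refl; trans to ≈-trans)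
  module ≈-Reasoning = SetoidReasoning ≈-setoid

  ≡⇒≈ : ∀ {a b} → a ≡ b → a ≈ b
  ≡⇒≈ refl = ≈-refl

  %-≈ : ∀ a → a % m ≈ a
  %-≈ a = mk≈ (m%n%n≡m%n a m)

  +-multiple-≈ : ∀ a c → a + c * m ≈ a
  +-multiple-≈ a c = mk≈ ([m+kn]%n≡m%n a c m)

  +-cong : ∀ {a b c d} → a ≈ b → c ≈ d → a + c ≈ b + d
  +-cong {a} {b} {c} {d} (mk≈ e) (mk≈ e′) = mk≈ (trans (%-distribˡ-+ a c m)
    (trans (cong₂ (λ x y → (x + y) % m) e e′) (sym (%-distribˡ-+ b d m))))

  *-cong : ∀ {a b c d} → a ≈ b → c ≈ d → a * c ≈ b * d
  *-cong {a} {b} {c} {d} (mk≈ e) (mk≈ e′) = mk≈ (trans (%-distribˡ-* a c m)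
    (trans (cong₂ (λ x y → (x * y) % m) e e′) (sym (%-distribˡ-* b d m))))

  +-congˡ : ∀ c {a b} → a ≈ b → c + a ≈ c + b
  +-congˡ c = +-cong (≈-refl {c})

  +-congʳ : ∀ c {a b} → a ≈ b → a + c ≈ b + c
  +-congʳ c a≈b = +-cong a≈b (≈-refl {c})

  *-congˡ : ∀ c {a b} → a ≈ b → c * a ≈ c * b
  *-congˡ c = *-cong (≈-refl {c})

  +-cancelʳ-≈ : ∀ a b c → a + c ≈ b + c → a ≈ b
  +-cancelʳ-≈ a b c a+c≈b+c = begin
    a                       ≈⟨ +-multiple-≈ a c ⟨
    a + c * m               ≡⟨ shift a ⟩
    (a + c) + c * pred m    ≈⟨ +-congʳ (c * pred m) a+c≈b+c ⟩
    (b + c) + c * pred m    ≡⟨ shift b ⟨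
    b + c * m               ≈⟨ +-multiple-≈ b c ⟩
    b                       ∎
    where
    open ≈-Reasoning
    shift : ∀ x → x + c * m ≡ (x + c) + c * pred m
    shift x = subst (λ m′ → x + c * m′ ≡ (x + c) + c * pred m′) (suc-pred m) (lemma x c (pred m))
      where
      lemma : ∀ x c p → x + c * suc p ≡ (x + c) + c * p
      lemma = solve-∀

  +-cancelˡ-≈ : ∀ c {a b} → c + a ≈ c + b → a ≈ b
  +-cancelˡ-≈ c {a} {b} c+a≈c+b =
    +-cancelʳ-≈ a b c (≈-trans (≡⇒≈ (+-comm a c)) (≈-trans c+a≈c+b (≡⇒≈ (+-comm c b))))

  <-≈⇒≡ : ∀ {a b} → a < m → b < m → a ≈ b → a ≡ b
  <-≈⇒≡ a<m b<m (mk≈ e) = trans (sym (m<n⇒m%n≡m a<m)) (trans e (m<n⇒m%n≡m b<m))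

  toℕ-≈⇒≡ : ∀ {a b : Fin m} → toℕ a ≈ toℕ b → a ≡ b
  toℕ-≈⇒≡ {a} {b} = toℕ-injective ∘′ <-≈⇒≡ (toℕ<n a) (toℕ<n b)

  toℕ-mod : ∀ a → toℕ (a mod m) ≈ a
  toℕ-mod a = subst (_≈ a) (sym (toℕ-fromℕ< (m%n<n a m))) (%-≈ a)

  ∸-≈ : ∀ {a} → m ≤ a → a ∸ m ≈ a
  ∸-≈ m≤a = mk≈ (m≤n⇒[n∸m]%m≡n%m m≤a)

2*2k≡4k : ∀ k → 2 * (2 * k) ≡ 4 * k
2*2k≡4k = solve-∀

2k≤4k : ∀ k → 2 * k ≤ 4 * k
2k≤4k k = subst (2 * k ≤_) (2*2k≡4k k) (m≤n*m (2 * k) 2)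

module OddModulus (k : ℕ) where

  open Congruence (suc (2 * k)) public

  private
    m : ℕ
    m = suc (2 * k)

  two-inverse : ∀ a → suc k * (2 * a) ≈ a
  two-inverse a = ≈-trans (≡⇒≈ (identity k a)) (+-multiple-≈ a a)
    where
    identity : ∀ k a → suc k * (2 * a) ≡ a + a * suc (2 * k)
    identity = solve-∀

  2*-cancel-≈ : ∀ {a b} → 2 * a ≈ 2 * b → a ≈ b
  2*-cancel-≈ {a} {b} 2a≈2b = begin
    a                  ≈⟨ two-inverse a ⟨
    suc k * (2 * a)    ≈⟨ *-congˡ (suc k) 2a≈2b ⟩
    suc k * (2 * b)    ≈⟨ two-inverse b ⟩
    b                  ∎
    where open ≈-Reasoning

  +2*-solvable : ∀ y z → ∃ λ f → f < m × y + 2 * f ≈ z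
  +2*-solvable y z = suc k * w % m , m%n<n (suc k * w) m , (begin
    y + 2 * (suc k * w % m)    ≈⟨ +-congˡ y (*-congˡ 2 (%-≈ (suc k * w))) ⟩
    y + 2 * (suc k * w)        ≡⟨ cong (y +_) (regroup k w) ⟩
    y + suc k * (2 * w)        ≈⟨ +-congˡ y (two-inverse w) ⟩
    y + w                      ≡⟨ identity k y z ⟩
    z + y * m                  ≈⟨ +-multiple-≈ z y ⟩
    z                          ∎)
    where
    open ≈-Reasoning
    -- f ≡ (k + 1)(z − y), with −y represented by 2k·y
    w : ℕ
    w = z + y * (2 * k)
    regroup : ∀ k w → 2 * (suc k * w) ≡ suc k * (2 * w)
    regroup = solve-∀
    identity : ∀ k y z → y + (z + y * (2 * k)) ≡ z + y * suc (2 * k)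
    identity = solve-∀

  ≤4k-≈2k⇒≡2k : ∀ {f} → f ≤ 4 * k → f ≈ 2 * k → f ≡ 2 * k
  ≤4k-≈2k⇒≡2k {f} f≤4k f≈2k with f <? m
  ... | yes f<m = <-≈⇒≡ f<m ≤-refl f≈2k
  ... | no  f≮m = contradiction (subst (_≤ 4 * k) f≡1+4k f≤4k) 1+n≰n
    where
    m≤f : m ≤ f
    m≤f = ≮⇒≥ f≮m
    f<2m : f < m + m
    f<2m = subst (f <_) (2+4k≡2m k) (s≤s (≤-trans f≤4k (n≤1+n (4 * k))))
      where
      2+4k≡2m : ∀ k → suc (suc (4 * k)) ≡ suc (2 * k) + suc (2 * k)
      2+4k≡2m = solve-∀
    f∸m≡2k : f ∸ m ≡ 2 * k
    f∸m≡2k = <-≈⇒≡ (m<n+o⇒m∸n<o f m f<2m) ≤-refl (≈-trans (∸-≈ m≤f) f≈2k)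
    f≡1+4k : f ≡ suc (4 * k)
    f≡1+4k = trans (sym (m∸n+n≡m m≤f)) (trans (cong (_+ m) f∸m≡2k) (2k+m≡1+4k k))
      where
      2k+m≡1+4k : ∀ k → 2 * k + suc (2 * k) ≡ suc (4 * k)
      2k+m≡1+4k = solve-∀

  forwardCount-loop : ∀ x {f} → f ≤ 4 * k → x + 2 * f ≈ x + 4 * k → f ≡ 2 * k
  forwardCount-loop x f≤4k x+2f≈x+4k = ≤4k-≈2k⇒≡2k f≤4k (2*-cancel-≈
    (≈-trans (+-cancelˡ-≈ x x+2f≈x+4k) (≡⇒≈ (sym (2*2k≡4k k)))))

  forwardCount-exists : ∀ (i j : Fin m) p → (p ≡ true → i ≢ j) →
    ∃ λ f → f ≤ 4 * k × oddᵇ f ≡ p × toℕ i + 2 * f ≈ toℕ j + 4 * k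
  forwardCount-exists i j p p⇒i≢j with +2*-solvable (toℕ i) (toℕ j + 4 * k)
  ... | f , f<m , i+2f≈j+4k with oddᵇ f Bool.≟ p | f ≟ 2 * k
  ...   | yes odd≡p | _        = f , ≤-trans (≤-pred f<m) (2k≤4k k) , odd≡p , i+2f≈j+4k
  ...   | no  odd≢p | yes refl = contradiction i≡j (p⇒i≢j p≡true)
    where
    p≡true : p ≡ true
    p≡true = trans (¬-not (odd≢p ∘′ sym)) (cong not (oddᵇ-2* k))
    i≡j : i ≡ j
    i≡j = toℕ-≈⇒≡ (+-cancelʳ-≈ (toℕ i) (toℕ j) (4 * k)
      (≈-trans (≡⇒≈ (cong (toℕ i +_) (sym (2*2k≡4k k)))) i+2f≈j+4k))
  ...   | no  odd≢p | no  f≢2k = m + f , m+f≤4k , odd[m+f]≡p , (begin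
    toℕ i + 2 * (m + f)        ≡⟨ identity (toℕ i) m f ⟩
    (toℕ i + 2 * f) + 2 * m    ≈⟨ +-multiple-≈ (toℕ i + 2 * f) 2 ⟩
    toℕ i + 2 * f              ≈⟨ i+2f≈j+4k ⟩
    toℕ j + 4 * k              ∎)
    where
    open ≈-Reasoning
    identity : ∀ x m f → x + 2 * (m + f) ≡ (x + 2 * f) + 2 * m
    identity = solve-∀
    m+f≤4k : m + f ≤ 4 * k
    m+f≤4k = subst₂ _≤_ (+-suc (2 * k) f) (2k+2k≡4k k)
      (+-monoʳ-≤ (2 * k) (≤∧≢⇒< (≤-pred f<m) f≢2k))
      where
      2k+2k≡4k : ∀ k → 2 * k + 2 * k ≡ 4 * k
      2k+2k≡4k = solve-∀
    odd[m+f]≡p : oddᵇ (m + f) ≡ p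
    odd[m+f]≡p = trans (cong not (trans (oddᵇ-+ (2 * k) f) (cong (_xor oddᵇ f) (oddᵇ-2* k))))
      (sym (¬-not (odd≢p ∘′ sym)))

forwardParity : ∀ {n} → OPath n → Bool
forwardParity P = oddᵇ (forwardArcs P)

forwardParity-∷ : ∀ {n} b (P : OPath n) → forwardParity (b ∷ P) ≡ b xor forwardParity P
forwardParity-∷ true  P = refl
forwardParity-∷ false P = refl

forwardParity-%2 : ∀ {n r} (P : OPath n) → forwardArcs P % 2 ≡ r → forwardParity P ≡ oddᵇ r
forwardParity-%2 P e = trans (sym (oddᵇ-%2 (forwardArcs P))) (cong oddᵇ e)

forwardParity-pushedArc : ∀ {n} (P : OPath n) (S : Fin (suc n) → Bool) →
  forwardParity (pushedArc P S) ≡ forwardParity P xor (S fzero xor S (fromℕ n))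
forwardParity-pushedArc []      S = sym (xor-same (S fzero))
forwardParity-pushedArc (p ∷ P) S = begin
  forwardParity (pushedArc (p ∷ P) S)
    ≡⟨ forwardParity-∷ (p xor (s₀ xor s₁)) (pushedArc P S′) ⟩
  (p xor (s₀ xor s₁)) xor forwardParity (pushedArc P S′)
    ≡⟨ cong ((p xor (s₀ xor s₁)) xor_) (forwardParity-pushedArc P S′) ⟩
  (p xor (s₀ xor s₁)) xor (forwardParity P xor (s₁ xor sₙ))
    ≡⟨ telescope p s₀ s₁ (forwardParity P) sₙ ⟩
  (p xor forwardParity P) xor (s₀ xor sₙ)
    ≡⟨ cong (_xor (s₀ xor sₙ)) (forwardParity-∷ p P) ⟨
  forwardParity (p ∷ P) xor (s₀ xor sₙ)
    ∎
  where
  open ≡-Reasoning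
  S′ = S ∘′ fsuc
  s₀ = S fzero
  s₁ = S (fsuc fzero)
  sₙ = S (fromℕ (suc _))
  telescope : ∀ p s₀ s₁ q sₙ →
    (p xor (s₀ xor s₁)) xor (q xor (s₁ xor sₙ)) ≡ (p xor q) xor (s₀ xor sₙ)
  telescope = solve 5 (λ p s₀ s₁ q sₙ →
    (p :+ (s₀ :+ s₁)) :+ (q :+ (s₁ :+ sₙ)) := (p :+ q) :+ (s₀ :+ sₙ)) refl

forwardParity-pushedArc-internal : ∀ {n} (P : OPath n) (S : Fin (suc n) → Bool) →
  S fzero ≡ false → S (fromℕ n) ≡ false → forwardParity (pushedArc P S) ≡ forwardParity P
forwardParity-pushedArc-internal {n} P S S₀≡false Sₙ≡false = begin
  forwardParity (pushedArc P S)                   ≡⟨ forwardParity-pushedArc P S ⟩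
  forwardParity P xor (S fzero xor S (fromℕ n))   ≡⟨ cong (forwardParity P xor_) (cong₂ _xor_ S₀≡false Sₙ≡false) ⟩
  forwardParity P xor false                       ≡⟨ xor-identityʳ (forwardParity P) ⟩
  forwardParity P                                 ∎
  where open ≡-Reasoning

reorienting : ∀ {n} (P Q : OPath n) → Bool → Fin (suc n) → Bool
reorienting P       Q       s fzero    = s
reorienting (p ∷ P) (q ∷ Q) s (fsuc j) = reorienting P Q (s xor (p xor q)) j

pushedArc-reorienting : ∀ {n} (P Q : OPath n) s → pushedArc P (reorienting P Q s) ≡ Q
pushedArc-reorienting []      []      s = refl
pushedArc-reorienting (p ∷ P) (q ∷ Q) s =
  cong₂ _∷_ (flip p s q) (pushedArc-reorienting P Q (s xor (p xor q)))
  where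
  flip : ∀ p s q → p xor (s xor (s xor (p xor q))) ≡ q
  flip = solve 3 (λ p s q → p :+ (s :+ (s :+ (p :+ q))) := q) refl

reorienting-last : ∀ {n} (P Q : OPath n) s →
  reorienting P Q s (fromℕ n) ≡ s xor (forwardParity P xor forwardParity Q)
reorienting-last []      []      s = sym (xor-identityʳ s)
reorienting-last (p ∷ P) (q ∷ Q) s = begin
  reorienting P Q (s xor (p xor q)) (fromℕ _)
    ≡⟨ reorienting-last P Q _ ⟩
  (s xor (p xor q)) xor (forwardParity P xor forwardParity Q)
    ≡⟨ regroup s p q (forwardParity P) (forwardParity Q) ⟩
  s xor ((p xor forwardParity P) xor (q xor forwardParity Q))
    ≡⟨ cong₂ (λ x y → s xor (x xor y)) (forwardParity-∷ p P) (forwardParity-∷ q Q) ⟨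
  s xor (forwardParity (p ∷ P) xor forwardParity (q ∷ Q))
    ∎
  where
  open ≡-Reasoning
  regroup : ∀ s p q x y → (s xor (p xor q)) xor (x xor y) ≡ s xor ((p xor x) xor (q xor y))
  regroup = solve 5 (λ s p q x y →
    (s :+ (p :+ q)) :+ (x :+ y) := s :+ ((p :+ x) :+ (q :+ y))) refl

reorienting-internal : ∀ {n} (P Q : OPath n) → forwardParity P ≡ forwardParity Q →
  reorienting P Q false (fromℕ n) ≡ false
reorienting-internal P Q same-parity = trans (reorienting-last P Q false)
  (subst (λ x → forwardParity P xor x ≡ false) same-parity (xor-same (forwardParity P)))

pathWithForwardArcs : (n f : ℕ) → OPath n
pathWithForwardArcs zero    f       = []
pathWithForwardArcs (suc n) zero    = false ∷ pathWithForwardArcs n zero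
pathWithForwardArcs (suc n) (suc f) = true ∷ pathWithForwardArcs n f

forwardArcs-pathWithForwardArcs : ∀ {n f} → f ≤ n → forwardArcs (pathWithForwardArcs n f) ≡ f
forwardArcs-pathWithForwardArcs {zero}  z≤n       = refl
forwardArcs-pathWithForwardArcs {suc n} z≤n       = forwardArcs-pathWithForwardArcs {n} z≤n
forwardArcs-pathWithForwardArcs         (s≤s f≤n) = cong suc (forwardArcs-pathWithForwardArcs f≤n)

module _ (k : ℕ) where

  open OddModulus k

  private
    m : ℕ
    m = suc (2 * k)

  ≈⇒cycArc : ∀ a b → toℕ b ≈ toℕ a + 1 → CycArc k a b
  ≈⇒cycArc a b (mk≈ e) = trans (sym (m<n⇒m%n≡m (toℕ<n b))) e

  cycArc⇒≈ : ∀ a b → CycArc k a b → toℕ b ≈ toℕ a + 1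
  cycArc⇒≈ a b arc = mk≈ (trans (m<n⇒m%n≡m (toℕ<n b)) arc)

  sucᶜ predᶜ : Color k → Color k
  sucᶜ  a = (toℕ a + 1) mod m
  predᶜ a = (toℕ a + 2 * k) mod m

  cycArc-sucᶜ : ∀ a → CycArc k a (sucᶜ a)
  cycArc-sucᶜ a = ≈⇒cycArc a (sucᶜ a) (toℕ-mod (toℕ a + 1))

  cycArc-predᶜ : ∀ a → CycArc k (predᶜ a) a
  cycArc-predᶜ a = ≈⇒cycArc (predᶜ a) a (begin
    toℕ a                    ≈⟨ +-multiple-≈ (toℕ a) 1 ⟨
    toℕ a + 1 * m            ≡⟨ identity (toℕ a) k ⟩
    (toℕ a + 2 * k) + 1      ≈⟨ +-congʳ 1 (toℕ-mod (toℕ a + 2 * k)) ⟨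
    toℕ (predᶜ a) + 1        ∎)
    where
    open ≈-Reasoning
    identity : ∀ x k → x + 1 * suc (2 * k) ≡ (x + 2 * k) + 1
    identity = solve-∀

  walkColouring : ∀ {n} → OPath n → Color k → Fin (suc n) → Color k
  walkColouring Q       i fzero    = i
  walkColouring (q ∷ Q) i (fsuc j) = walkColouring Q (if q then sucᶜ i else predᶜ i) j

  walkColouring-isHom : ∀ {n} (Q : OPath n) i → IsHom k Q (walkColouring Q i)
  walkColouring-isHom (true  ∷ Q) i fzero    = cycArc-sucᶜ i
  walkColouring-isHom (false ∷ Q) i fzero    = cycArc-predᶜ i
  walkColouring-isHom (true  ∷ Q) i (fsuc j) = walkColouring-isHom Q (sucᶜ i) j
  walkColouring-isHom (false ∷ Q) i (fsuc j) = walkColouring-isHom Q (predᶜ i) j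

  -- the subtraction-free form of c(w_n) ≡ c(w_0) + f − (n − f)
  isHom-endpoints : ∀ {n} (Q : OPath n) c → IsHom k Q c →
    toℕ (c fzero) + 2 * forwardArcs Q ≈ toℕ (c (fromℕ n)) + n
  isHom-endpoints []      c _   = ≈-refl
  isHom-endpoints {suc n} (q ∷ Q) c hom = begin
    c₀ + 2 * forwardArcs (q ∷ Q)   ≈⟨ first-arc q (hom fzero) ⟩
    (c₁ + 2 * f) + 1               ≈⟨ +-congʳ 1 (isHom-endpoints Q c′ (λ j → hom (fsuc j))) ⟩
    (cₙ + n) + 1                   ≡⟨ +-comm (cₙ + n) 1 ⟩
    suc (cₙ + n)                   ≡⟨ +-suc cₙ n ⟨
    cₙ + suc n                     ∎
    where
    open ≈-Reasoning
    f = forwardArcs Q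
    c′ = c ∘′ fsuc
    c₀ = toℕ (c fzero)
    c₁ = toℕ (c′ fzero)
    cₙ = toℕ (c′ (fromℕ n))
    first-arc : ∀ q → (if q then CycArc k (c fzero) (c′ fzero) else CycArc k (c′ fzero) (c fzero)) →
      c₀ + 2 * forwardArcs (q ∷ Q) ≈ (c₁ + 2 * f) + 1
    first-arc true  arc = begin
      c₀ + 2 * suc f          ≡⟨ regroup c₀ f ⟩
      ((c₀ + 1) + 2 * f) + 1  ≈⟨ +-congʳ 1 (+-congʳ (2 * f) (cycArc⇒≈ (c fzero) (c′ fzero) arc)) ⟨
      (c₁ + 2 * f) + 1        ∎
      where
      regroup : ∀ c f → c + 2 * suc f ≡ ((c + 1) + 2 * f) + 1
      regroup = solve-∀
    first-arc false arc = begin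
      c₀ + 2 * f              ≈⟨ +-congʳ (2 * f) (cycArc⇒≈ (c′ fzero) (c fzero) arc) ⟩
      (c₁ + 1) + 2 * f        ≡⟨ regroup c₁ f ⟩
      (c₁ + 2 * f) + 1        ∎
      where
      regroup : ∀ c f → (c + 1) + 2 * f ≡ (c + 2 * f) + 1
      regroup = solve-∀

  AllowingForwardCount : ∀ {n} → OPath n → Color k → Color k → ℕ → Set
  AllowingForwardCount {n} P i j f =
    f ≤ n × oddᵇ f ≡ forwardParity P × toℕ i + 2 * f ≈ toℕ j + n

  allows⇔allowingForwardCount : ∀ {n} (P : OPath n) i j →
    Allows k P i j ⇔ ∃ (AllowingForwardCount P i j)
  allows⇔allowingForwardCount {n} P i j = mk⇔ to from
    where
    to : Allows k P i j → ∃ (AllowingForwardCount P i j)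
    to (S , S₀≡false , Sₙ≡false , c , hom , refl , refl) =
      forwardArcs Q , count≤n _ Q , forwardParity-pushedArc-internal P S S₀≡false Sₙ≡false ,
      isHom-endpoints Q c hom
      where
      Q = pushedArc P S
    from : ∃ (AllowingForwardCount P i j) → Allows k P i j
    from (f , f≤n , parity , i+2f≈j+n) = S , refl , Sₙ≡false , c , hom , refl , cₙ≡j
      where
      Q = pathWithForwardArcs n f
      forwardArcs≡f : forwardArcs Q ≡ f
      forwardArcs≡f = forwardArcs-pathWithForwardArcs f≤n
      S = reorienting P Q false
      Sₙ≡false : S (fromℕ n) ≡ false
      Sₙ≡false = reorienting-internal P Q (sym (trans (cong oddᵇ forwardArcs≡f) parity))
      c = walkColouring Q i
      hom : IsHom k (pushedArc P S) c
      hom = subst (λ R → IsHom k R c) (sym (pushedArc-reorienting P Q false)) (walkColouring-isHom Q i)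
      cₙ≡j : c (fromℕ n) ≡ j
      cₙ≡j = toℕ-≈⇒≡ (+-cancelʳ-≈ (toℕ (c (fromℕ n))) (toℕ j) n (begin
        toℕ (c (fromℕ n)) + n      ≈⟨ isHom-endpoints Q c (walkColouring-isHom Q i) ⟨
        toℕ i + 2 * forwardArcs Q  ≡⟨ cong (λ x → toℕ i + 2 * x) forwardArcs≡f ⟩
        toℕ i + 2 * f              ≈⟨ i+2f≈j+n ⟩
        toℕ j + n                  ∎))
        where open ≈-Reasoning

  allows-4k : (P : OPath (4 * k)) (i j : Color k) →
    (forwardParity P ≡ true → i ≢ j) → Allows k P i j
  allows-4k P i j odd⇒i≢j = Equivalence.from (allows⇔allowingForwardCount P i j)
    (forwardCount-exists i j (forwardParity P) odd⇒i≢j)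

  ¬allows-4k-loop : (P : OPath (4 * k)) → forwardParity P ≡ true → ∀ i → ¬ Allows k P i i
  ¬allows-4k-loop P odd i allows with Equivalence.to (allows⇔allowingForwardCount P i i) allows
  ... | f , f≤4k , parity , i+2f≈i+4k = contradiction odd (not-¬ (begin
    forwardParity P   ≡⟨ parity ⟨
    oddᵇ f            ≡⟨ cong oddᵇ (forwardCount-loop (toℕ i) f≤4k i+2f≈i+4k) ⟩
    oddᵇ (2 * k)      ≡⟨ oddᵇ-2* k ⟩
    false             ∎))
    where open ≡-Reasoning

mainTheorem19 : (k : ℕ) → k ≥ 1 →
    ((P : OPath (4 * k)) → forwardArcs P % 2 ≡ 0 →
      (i j : Color k) → Allows k P i j)
    ×
    ((P′ : OPath (4 * k)) → forwardArcs P′ % 2 ≡ 1 →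
      (i : Color k) → ((j : Color k) → j ≢ i → Allows k P′ i j) × ¬ Allows k P′ i i)
mainTheorem19 k _ =
  (λ P even i j → allows-4k k P i j (λ odd → contradiction odd (not-¬ (forwardParity-%2 P even)))) ,
  (λ P′ odd i → (λ j j≢i → allows-4k k P′ i j (λ _ i≡j → j≢i (sym i≡j))) ,
                ¬allows-4k-loop k P′ (forwardParity-%2 P′ odd) i)
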